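{- Let $H=(V,E)$ be a hypergraph and $g:E\to(0,1]$. If some basic fractional matching of $H$ is stuck for $g$, then $H$ has no singleton edges (edges $e$ with $|e|=1$).
   Context: A hypergraph $H=(V,E)$ has finite vertex set $V$ and a finite set $E$ of nonempty subsets of $V$. For an edge $e$, $N(e)=\{f\in E: f\neq e,\ f\cap e\neq\emptyset\}$. A fractional matching of $H$ is $x:E\to[0,1]$ with $\sum_{e\ni v}x(e)\le 1$ for all $v\in V$; it is basic if it is an extreme point of the fractional matching polytope. A basic fractional matching $x$ is stuck for $g$ if for every $e\in E$, $\sum_{f\in N(e)}g(f)x(f)>1-g(e)x(e)$.
   Formalization: The values of g and of the stuck basic fractional matching are rational, and the fractional matchings tested in the extreme-point condition also take values in ℚ. -}

module Defs where

open import Data.Nat using (ℕ; zero; suc)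
open import Data.Fin using (Fin; zero; suc)
open import Data.Fin.Properties using (_≟_)
open import Data.Fin.Subset using (Subset; _∈_; _∩_; Nonempty)
open import Data.Fin.Subset.Properties using (_∈?_; nonempty?)
open import Data.Rational using (ℚ; 0ℚ; 1ℚ; _+_; _*_; _-_; _≤_; _<_)
open import Data.Product using (_×_)
open import Relation.Binary.PropositionalEquality using (_≡_; _≢_)
open import Relation.Nullary using (yes; no)
open import Function.Definitions using (Injective)

Σ : ∀ {m} → (Fin m → ℚ) → ℚ
Σ {zero}  f = 0ℚ
Σ {suc m} f = f zero + Σ (λ i → f (suc i))

record Hypergraph : Set where
  field
    n        : ℕ
    m        : ℕ
    edge     : Fin m → Subset n
    nonempty : ∀ i → Nonempty (edge i)
    distinct : Injective _≡_ _≡_ edge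
open Hypergraph public

module _ (H : Hypergraph) where

  vertexSum : (Fin (m H) → ℚ) → Fin (n H) → ℚ
  vertexSum x v = Σ (λ e → case? (v ∈? edge H e) (x e))
    where
    open import Relation.Nullary using (Dec)
    case? : ∀ {A : Set} → Dec A → ℚ → ℚ
    case? (yes _) q = q
    case? (no _)  q = 0ℚ

  IsFractionalMatching : (Fin (m H) → ℚ) → Set
  IsFractionalMatching x =
    (∀ e → 0ℚ ≤ x e × x e ≤ 1ℚ) × (∀ v → vertexSum x v ≤ 1ℚ)

  IsBasic : (Fin (m H) → ℚ) → Set
  IsBasic x = IsFractionalMatching x ×
    (∀ (y z : Fin (m H) → ℚ) (t : ℚ) →
       IsFractionalMatching y → IsFractionalMatching z →
       0ℚ < t → t < 1ℚ →
       (∀ e → x e ≡ t * y e + (1ℚ - t) * z e) →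
       ∀ e → y e ≡ z e)

  -- Σ_{f ∈ N(e)} w f, where N(e) = edges f ≠ e meeting e
  neighbourSum : Fin (m H) → (Fin (m H) → ℚ) → ℚ
  neighbourSum e w = Σ (λ f → pick (f ≟ e) (nonempty? (edge H f ∩ edge H e)) (w f))
    where
    open import Relation.Nullary using (Dec)
    pick : ∀ {A B : Set} → Dec A → Dec B → ℚ → ℚ
    pick (no _) (yes _) q = q
    pick _      _       q = 0ℚ

  IsStuck : (g x : Fin (m H) → ℚ) → Set
  IsStuck g x = IsBasic x ×
    (∀ e → 1ℚ - g e * x e < neighbourSum e (λ f → g f * x f))

{-# OPTIONS --safe #-}
module Submission where

-- If e = {v}, every neighbour of e contains v, so by the vertex constraint at v the
-- neighbours of e carry x-weight at most 1 − x(e); as g ≤ 1, their g-weighted sum is at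
-- most 1 − x(e) ≤ 1 − g(e) x(e), contradicting stuckness at e.

open import Defs
open import Algebra.Bundles using (CommutativeMonoid)
open import Data.Fin using (Fin; zero; suc)
open import Data.Fin.Properties using (_≟_; suc-injective)
open import Data.Fin.Subset using (Subset; ∣_∣; _∈_; _⊆_; ⁅_⁆; _-_; _∩_; Nonempty)
open import Data.Fin.Subset.Properties
  using (_∈?_; nonempty?; x∈⁅x⁆; x∈⁅y⁆⇒x≡y; ∣⁅x⁆∣≡1; p⊆q⇒∣p∣≤∣q∣; x∈p⇒∣p-x∣<∣p∣; x∈p∧x≢y⇒x∈p-y; x∈p∩q⁻)
open import Data.Nat using (zero; suc)
import Data.Nat.Properties as ℕ
open import Data.Product using (_×_; ∃; _,_; proj₁; proj₂)
open import Data.Rational using (ℚ; 0ℚ; 1ℚ; _+_; _*_; _≤_; _<_; nonNegative)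
  renaming (_-_ to _-ℚ_)
open import Data.Rational.Properties
  using (≤-refl; <-irrefl; +-assoc; +-mono-≤; +-monoʳ-≤; +-monoˡ-<; *-monoʳ-≤-nonNeg; *-identityˡ;
         +-identityˡ; +-0-commutativeMonoid; +-0-group; module ≤-Reasoning)
open import Data.Empty using (⊥-elim)
open import Function using (_∘_)
open import Relation.Binary.PropositionalEquality using (_≡_; _≢_; refl; sym; trans; subst; cong)
open import Relation.Nullary using (yes; no)
open import Algebra.Properties.CommutativeSemigroup (CommutativeMonoid.commutativeSemigroup +-0-commutativeMonoid)
  using (xy∙z≈xz∙y)
open import Algebra.Properties.Group +-0-group using (//-rightDividesˡ)

∣p∣≡1⇒p⊆⁅x⁆ : ∀ {k} {p : Subset k} {x : Fin k} → ∣ p ∣ ≡ 1 → x ∈ p → p ⊆ ⁅ x ⁆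
∣p∣≡1⇒p⊆⁅x⁆ {p = p} {x} ∣p∣≡1 x∈p {y} y∈p with y ≟ x
... | yes refl = x∈⁅x⁆ x
... | no y≢x   = ⊥-elim (ℕ.<-irrefl (trans (∣⁅x⁆∣≡1 y) (sym ∣p∣≡1))
                          (ℕ.≤-<-trans (p⊆q⇒∣p∣≤∣q∣ ⁅y⁆⊆p-x) (x∈p⇒∣p-x∣<∣p∣ x∈p)))
  where
  ⁅y⁆⊆p-x : ⁅ y ⁆ ⊆ p - x
  ⁅y⁆⊆p-x z∈⁅y⁆ = subst (_∈ p - x) (sym (x∈⁅y⁆⇒x≡y y z∈⁅y⁆)) (x∈p∧x≢y⇒x∈p-y y∈p y≢x)

p∩q≢∅∧q⊆⁅x⁆⇒x∈p : ∀ {k} {p q : Subset k} {x : Fin k} → Nonempty (p ∩ q) → q ⊆ ⁅ x ⁆ → x ∈ p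
p∩q≢∅∧q⊆⁅x⁆⇒x∈p {p = p} {q} (y , y∈p∩q) q⊆⁅x⁆ with x∈p∩q⁻ p q y∈p∩q
... | y∈p , y∈q = subst (_∈ p) (x∈⁅y⁆⇒x≡y _ (q⊆⁅x⁆ y∈q)) y∈p

Σ-mono-≤ : ∀ {k} {a b : Fin k → ℚ} → (∀ i → a i ≤ b i) → Σ a ≤ Σ b
Σ-mono-≤ {zero}  _   = ≤-refl
Σ-mono-≤ {suc k} a≤b = +-mono-≤ (a≤b zero) (Σ-mono-≤ (a≤b ∘ suc))

Σa+c≤Σb : ∀ {k} {a b : Fin k → ℚ} {c : ℚ} (j : Fin k) →
          (∀ i → i ≢ j → a i ≤ b i) → a j + c ≤ b j → Σ a + c ≤ Σ b
Σa+c≤Σb {suc k} {a} {b} {c} zero a≤b aj+c≤bj = begin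
  (a zero + Σ (a ∘ suc)) + c  ≡⟨ xy∙z≈xz∙y (a zero) (Σ (a ∘ suc)) c ⟩
  (a zero + c) + Σ (a ∘ suc)  ≤⟨ +-mono-≤ aj+c≤bj (Σ-mono-≤ (λ i → a≤b (suc i) λ ())) ⟩
  b zero + Σ (b ∘ suc)        ∎
  where open ≤-Reasoning
Σa+c≤Σb {suc k} {a} {b} {c} (suc j) a≤b aj+c≤bj = begin
  (a zero + Σ (a ∘ suc)) + c  ≡⟨ +-assoc (a zero) (Σ (a ∘ suc)) c ⟩
  a zero + (Σ (a ∘ suc) + c)  ≤⟨ +-mono-≤ (a≤b zero λ ()) (Σa+c≤Σb j a∘suc≤b∘suc aj+c≤bj) ⟩
  b zero + Σ (b ∘ suc)        ∎
  where
  open ≤-Reasoning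
  a∘suc≤b∘suc : ∀ i → i ≢ j → a (suc i) ≤ b (suc i)
  a∘suc≤b∘suc i i≢j = a≤b (suc i) (i≢j ∘ suc-injective)

p≤1⇒p*q≤q : ∀ {p q : ℚ} → 0ℚ ≤ q → p ≤ 1ℚ → p * q ≤ q
p≤1⇒p*q≤q {p} {q} 0≤q p≤1 = begin
  p * q   ≤⟨ *-monoʳ-≤-nonNeg q {{nonNegative 0≤q}} p≤1 ⟩
  1ℚ * q  ≡⟨ *-identityˡ q ⟩
  q       ∎
  where open ≤-Reasoning

p-q<r⇒p<r+q : ∀ {p q r : ℚ} → p -ℚ q < r → p < r + q
p-q<r⇒p<r+q {p} {q} {r} p-q<r = begin-strict
  p             ≡⟨ sym (//-rightDividesˡ q p) ⟩
  (p -ℚ q) + q  <⟨ +-monoˡ-< q p-q<r ⟩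
  r + q         ∎
  where open ≤-Reasoning

module _ (H : Hypergraph) where

  -- Defs builds the summands of these sums with private helpers; unification against
  -- the sums recovers them, so that they can be reasoned about one by one.
  neighbourTerm : Fin (m H) → (Fin (m H) → ℚ) → Fin (m H) → ℚ
  neighbourTerm e w = proj₁ {B = λ a → Σ a ≡ neighbourSum H e w} (_ , refl)

  vertexTerm : (Fin (m H) → ℚ) → Fin (n H) → Fin (m H) → ℚ
  vertexTerm x v = proj₁ {B = λ a → Σ a ≡ vertexSum H x v} (_ , refl)

  neighbourTerm-self : ∀ e w → neighbourTerm e w e ≡ 0ℚ
  neighbourTerm-self e w with e ≟ e
  ... | yes _   = refl
  ... | no e≢e  = ⊥-elim (e≢e refl)

  vertexTerm-∈ : ∀ x {v f} → v ∈ edge H f → vertexTerm x v f ≡ x f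
  vertexTerm-∈ x {v} {f} v∈f with v ∈? edge H f
  ... | yes _   = refl
  ... | no v∉f  = ⊥-elim (v∉f v∈f)

  neighbourTerm≤vertexTerm : ∀ {e v w x f} → edge H e ⊆ ⁅ v ⁆ → 0ℚ ≤ x f → w f ≤ x f → f ≢ e →
                             neighbourTerm e w f ≤ vertexTerm x v f
  neighbourTerm≤vertexTerm {e} {v} {f = f} e⊆⁅v⁆ 0≤xf wf≤xf f≢e
    with f ≟ e | nonempty? (edge H f ∩ edge H e) | v ∈? edge H f
  ... | yes f≡e | _          | _      = ⊥-elim (f≢e f≡e)
  ... | no _    | yes _      | yes _  = wf≤xf
  ... | no _    | yes f∩e≢∅ | no v∉f = ⊥-elim (v∉f (p∩q≢∅∧q⊆⁅x⁆⇒x∈p f∩e≢∅ e⊆⁅v⁆))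
  ... | no _    | no _       | yes _  = 0≤xf
  ... | no _    | no _       | no _   = ≤-refl

  neighbourSum+x≤vertexSum : ∀ {e v w x} → edge H e ⊆ ⁅ v ⁆ → v ∈ edge H e →
                             (∀ f → 0ℚ ≤ x f) → (∀ f → w f ≤ x f) →
                             neighbourSum H e w + x e ≤ vertexSum H x v
  neighbourSum+x≤vertexSum {e} {v} {w} {x} e⊆⁅v⁆ v∈e 0≤x w≤x =
    Σa+c≤Σb e (λ f → neighbourTerm≤vertexTerm {w = w} {x} e⊆⁅v⁆ (0≤x f) (w≤x f)) (begin
      neighbourTerm e w e + x e  ≡⟨ cong (_+ x e) (neighbourTerm-self e w) ⟩
      0ℚ + x e                   ≡⟨ +-identityˡ (x e) ⟩
      x e                        ≡⟨ sym (vertexTerm-∈ x v∈e) ⟩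
      vertexTerm x v e           ∎)
    where open ≤-Reasoning

proposition13 : (H : Hypergraph) (g : Fin (m H) → ℚ) →
    (∀ e → 0ℚ < g e × g e ≤ 1ℚ) →
    (∃ λ x → IsStuck H g x) →
    ∀ e → ∣ edge H e ∣ ≢ 1
proposition13 H g g-bounds (x , ((x-bounds , x-vertex) , _) , stuck) e ∣e∣≡1 with nonempty H e
... | v , v∈e = <-irrefl refl (begin-strict
  1ℚ                          <⟨ p-q<r⇒p<r+q (stuck e) ⟩
  neighbourSum H e gx + gx e  ≤⟨ +-monoʳ-≤ (neighbourSum H e gx) (gx≤x e) ⟩
  neighbourSum H e gx + x e   ≤⟨ neighbourSum+x≤vertexSum H {w = gx} e⊆⁅v⁆ v∈e (proj₁ ∘ x-bounds) gx≤x ⟩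
  vertexSum H x v             ≤⟨ x-vertex v ⟩
  1ℚ                          ∎)
  where
  open ≤-Reasoning
  gx : Fin (m H) → ℚ
  gx f = g f * x f
  gx≤x : ∀ f → gx f ≤ x f
  gx≤x f = p≤1⇒p*q≤q (proj₁ (x-bounds f)) (proj₂ (g-bounds f))
  e⊆⁅v⁆ : edge H e ⊆ ⁅ v ⁆
  e⊆⁅v⁆ = ∣p∣≡1⇒p⊆⁅x⁆ ∣e∣≡1 v∈e
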